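{- Let $P,Q\in\mathbb{Z}$ with $PQ\neq 0$, let $p$ be a prime with $p\nmid\gcd(P,Q)$, and let $r\geq 1$ be an integer. Then \[ \mathcal{L}(P,Q,p^{ -r})= \begin{cases} \{0\} & \text{if } p\mid Q,\\ \langle p^{(r-\nu)_+}\rho\rangle & \text{if } p\geq 3 \text{ and } p\nmid Q,\\ \langle 2^{1+(r-\nu_2(P))_+}\rangle & \text{if } p=2\mid P \text{ and } 2\nmid Q,\\ \langle 3\cdot 2^{(r-\nu_2(U_3))_+}\rangle & \text{if } p=2,\ 2\nmid P,\ 2\nmid Q,\ Q\equiv 1 \pmod 4,\\ \langle 3\rangle & \text{if } p=2,\ 2\nmid P,\ 2\nmid Q,\ Q\equiv -1 \pmod 4,\ r=1,\\ \langle 6\cdot 2^{(r-\nu_2(U_6))_+}\rangle & \text{if } p=2,\ 2\nmid P,\ 2\nmid Q,\ Q\equiv -1 \pmod 4,\ r\neq 1. \end{cases} \]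
   Context: $\mathbb{N}=\{0,1,2,\ldots\}$. For $P,Q\in\mathbb{Z}$, the Lucas sequence $U_n=U_n(P,Q)$ is defined by $U_0=0$, $U_1=1$, $U_{n+2}=PU_{n+1}-QU_n$. For $R\in\mathbb{Q}$, $\mathcal{L}(P,Q,R)=\{n\in\mathbb{N} : U_nR\in\mathbb{Z}\}$; so $\mathcal{L}(P,Q,p^{ -r})=\{n:\nu_p(U_n)\geq r\}$, where $\nu_p$ is the $p$-adic valuation. $\langle\cdot\rangle$ denotes the generated additive subsemigroup of $\mathbb{N}$. $(x)_+=\max\{x,0\}$. When $p\nmid Q$, the rank of appearance $\rho=\rho(p)$ of $p$ in $U_n$ is the least integer $\rho\geq 2$ with $p\mid U_\rho$ (it exists), and the rank exponent is $\nu=\nu_p(U_\rho)$. -}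

module Defs where

open import Data.Nat as ℕ using (ℕ; zero; suc; _∸_; _^_; _/_)
open import Data.Nat.Divisibility using (_∣?_)
open import Data.Integer as ℤ using (ℤ; +_; ∣_∣)
open import Data.Integer.Divisibility as ℤD using ()
open import Relation.Nullary using (yes; no)
open import Data.Product using (_×_)
open import Relation.Binary.PropositionalEquality using (_≡_)

U : ℤ → ℤ → ℕ → ℤ
U P Q zero = ℤ.0ℤ
U P Q (suc zero) = ℤ.1ℤ
U P Q (suc (suc n)) = P ℤ.* U P Q (suc n) ℤ.- Q ℤ.* U P Q n

-- Membership in L(P,Q,p^{-r}) = { n : U_n p^{-r} ∈ ℤ } = { n : p^r ∣ U_n }
InL : ℤ → ℤ → ℕ → ℕ → ℕ → Set
InL P Q p r n = (+ (p ^ r)) ℤD.∣ U P Q n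

-- extended naturals for p-adic valuations (ν_p(0) = ∞)
data ℕ∞ : Set where
  fin : ℕ → ℕ∞
  ∞   : ℕ∞

-- number of times p divides m, with fuel (fuel = m suffices when p ≥ 2, m ≥ 1)
countDiv : ℕ → ℕ → ℕ → ℕ
countDiv zero _ _ = 0
countDiv (suc zero) _ _ = 0
countDiv (suc (suc q)) zero m = 0
countDiv (suc (suc q)) (suc f) m with suc (suc q) ∣? m
... | yes _ = suc (countDiv (suc (suc q)) f (m / suc (suc q)))
... | no _ = 0

-- p-adic valuation ν_p of an integer (meaningful for p ≥ 2); ν_p(0) = ∞
ν : ℕ → ℤ → ℕ∞
ν p x with ∣ x ∣
... | zero = ∞
... | suc m = fin (countDiv p (suc m) (suc m))

posSub : ℕ → ℕ∞ → ℕ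
posSub r (fin k) = r ∸ k
posSub r ∞ = 0

data ⟨_⟩ (a : ℕ) : ℕ → Set where
  gen0 : ⟨ a ⟩ 0
  gen  : ⟨ a ⟩ a
  add  : ∀ {m n} → ⟨ a ⟩ m → ⟨ a ⟩ n → ⟨ a ⟩ (m ℕ.+ n)

_≐_ : (ℕ → Set) → (ℕ → Set) → Set
A ≐ B = ∀ n → (A n → B n) × (B n → A n)

Zero : ℕ → Set
Zero n = n ≡ 0

IsRank : ℤ → ℤ → ℕ → ℕ → Set
IsRank P Q p ρ = (2 ℕ.≤ ρ) × ((+ p) ℤD.∣ U P Q ρ)
               × (∀ m → 2 ℕ.≤ m → (+ p) ℤD.∣ U P Q m → ρ ℕ.≤ m)

module Submission where

-- If p ∣ Q then p ∤ P, and U(n+2) ≡ P U(n+1) (mod p) keeps every U(n+1) prime to p.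
-- Otherwise no two consecutive terms are divisible by p, so by the addition formula
-- U(m+n) = U m U(n+1) + U(m+1) U n − P U m U n the n with p ∣ U n are the multiples
-- of the rank. Expanding U(kn) in powers of U n gives the lifting laws
-- ν(U(kn)) = ν(U n) for p ∤ k and ν(U(pn)) = ν(U n) + 1 for odd p (for p = 2 as soon
-- as 4 ∣ P U n). So if d is a rank at which the valuation t = ν(U d) already lifts,
-- p^(t+e) ∣ U n iff d p^e ∣ n, and below t the condition is just d ∣ n. For p = 2 the
-- role of d is played by 2, 3 or 6, according to the parity of P and to Q mod 4.

open import Data.Empty using (⊥-elim)
open import Data.Integer as ℤ using (ℤ; +_; _+_; _*_; _-_; -_; _^_; 0ℤ; 1ℤ) renaming (∣_∣ to abs)
import Data.Integer.DivMod as ℤDM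
import Data.Integer.Divisibility as ℤD
open import Data.Integer.Divisibility.Signed
open import Data.Integer.GCD using (gcd; gcd-greatest)
import Data.Integer.Properties as ℤP
open import Data.Integer.Tactic.RingSolver using (solve-∀)
open import Data.Nat.Tactic.RingSolver using () renaming (solve-∀ to ℕ-solve-∀)
open import Data.Nat as ℕ using (ℕ; zero; suc; z≤n; s≤s)
import Data.Nat.Divisibility as ℕD
open import Data.Nat.DivMod using (m≡m%n+[m/n]*n; m%n<n; m*n/n≡m)
open import Data.Nat.Primality using (Prime; euclidsLemma; ¬prime[1]; prime[2]; prime⇒nonZero; prime⇒nonTrivial)
import Data.Nat.Properties as ℕP
open import Data.Product using (Σ; _×_; _,_; proj₁; proj₂)
open import Data.Sum using (_⊎_; inj₁; inj₂; [_,_]′) renaming (map to ⊎-map)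
open import Function.Bundles using (_⇔_; mk⇔; Equivalence)
open import Relation.Binary.PropositionalEquality
open import Relation.Nullary using (¬_; yes; no)
open import Defs

⟨⟩⇔∣ : ∀ {a n} → ⟨ a ⟩ n ⇔ a ℕD.∣ n
⟨⟩⇔∣ {a} = mk⇔ to from
  where
  to : ∀ {n} → ⟨ a ⟩ n → a ℕD.∣ n
  to gen0 = a ℕD.∣0
  to gen = ℕD.∣-refl
  to (add x y) = ℕD.∣m∣n⇒∣m+n (to x) (to y)

  multiple : ∀ c → ⟨ a ⟩ (c ℕ.* a)
  multiple zero = gen0
  multiple (suc c) = add gen (multiple c)

  from : ∀ {n} → a ℕD.∣ n → ⟨ a ⟩ n
  from (ℕD.divides c refl) = multiple c

module Lucas (P Q : ℤ) where

  u : ℕ → ℤ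
  u = U P Q

  u-+ : ∀ m n → u (m ℕ.+ n) ≡ u m * u (suc n) + u (suc m) * u n - P * u m * u n
  u-+ zero n = ring (u (suc n)) (u n) P
    where
    ring : ∀ x y P → y ≡ 0ℤ * x + 1ℤ * y - P * 0ℤ * y
    ring = solve-∀
  u-+ (suc zero) n = ring (u (suc n)) (u n) P Q
    where
    ring : ∀ x y P Q → x ≡ 1ℤ * x + (P * 1ℤ - Q * 0ℤ) * y - P * 1ℤ * y
    ring = solve-∀
  u-+ (suc (suc m)) n =
    trans (cong₂ (λ x y → P * x - Q * y) (u-+ (suc m) n) (u-+ m n))
          (ring P Q (u (suc m)) (u m) (u (suc n)) (u n))
    where
    ring : ∀ P Q a₁ a₀ x y →
      P * (a₁ * x + (P * a₁ - Q * a₀) * y - P * a₁ * y) - Q * (a₀ * x + a₁ * y - P * a₀ * y)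
      ≡ (P * a₁ - Q * a₀) * x + (P * (P * a₁ - Q * a₀) - Q * a₁) * y - P * (P * a₁ - Q * a₀) * y
    ring = solve-∀

  ∣u⇒∣u-* : ∀ {x} d c → x ∣ u d → x ∣ u (c ℕ.* d)
  ∣u⇒∣u-* d zero _ = divides 0ℤ refl
  ∣u⇒∣u-* {x} d (suc c) x∣ud = subst (x ∣_) (sym (u-+ d (c ℕ.* d)))
    (∣m∣n⇒∣m-n (∣m∣n⇒∣m+n (∣m⇒∣m*n _ x∣ud) (∣n⇒∣m*n (u (suc d)) x∣ucd))
               (∣n⇒∣m*n (P * u d) x∣ucd))
    where
    x∣ucd : x ∣ u (c ℕ.* d)
    x∣ucd = ∣u⇒∣u-* d c x∣ud

  u-double : ∀ n → u (2 ℕ.* n) ≡ u n * ((+ 2) * u (suc n) - P * u n)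
  u-double n = begin
    u (n ℕ.+ (n ℕ.+ 0))      ≡⟨ cong (λ k → u (n ℕ.+ k)) (ℕP.+-identityʳ n) ⟩
    u (n ℕ.+ n)              ≡⟨ u-+ n n ⟩
    u n * u (suc n) + u (suc n) * u n - P * u n * u n
                             ≡⟨ ring P (u n) (u (suc n)) ⟩
    u n * ((+ 2) * u (suc n) - P * u n) ∎
    where
    open ≡-Reasoning
    ring : ∀ P a b → a * b + b * a - P * a * a ≡ a * ((+ 2) * b - P * a)
    ring = solve-∀

  u-2 : u 2 ≡ P
  u-2 = ring P Q
    where
    ring : ∀ P Q → P * 1ℤ - Q * 0ℤ ≡ P
    ring = solve-∀

  u-3 : u 3 ≡ P * P - Q
  u-3 = ring P Q
    where
    ring : ∀ P Q → P * (P * 1ℤ - Q * 0ℤ) - Q * 1ℤ ≡ P * P - Q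
    ring = solve-∀

  -- Expanding U((k+1)n) in powers of a = U n, with b = U(n+1): the linear
  -- coefficient is (k+1)b^k and G k is the quadratic one.
  module Expansion (n : ℕ) where

    a b : ℤ
    a = u n
    b = u (suc n)

    G : ℕ → ℤ
    G zero = 0ℤ
    G (suc k) = G k * b - P * (+ suc k) * b ^ k

    u-*-expansion : ∀ k → Σ ℤ λ X → Σ ℤ λ Y →
        u (suc k ℕ.* n) ≡ (+ suc k) * b ^ k * a + a * a * G k + a * a * a * X
      × u (suc (suc k ℕ.* n)) ≡ b ^ suc k + a * a * Y
    u-*-expansion zero rewrite ℕP.+-identityʳ n = 0ℤ , 0ℤ , ring₀ a , ring₁ a b
      where
      ring₀ : ∀ a → a ≡ 1ℤ * 1ℤ * a + a * a * 0ℤ + a * a * a * 0ℤ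
      ring₀ = solve-∀
      ring₁ : ∀ a b → b ≡ b * 1ℤ + a * a * 0ℤ
      ring₁ = solve-∀
    u-*-expansion (suc k) with u-*-expansion k
    ... | X , Y , eqₖ , eqₖ₊₁ =
        Y + b * X - P * G k - P * a * X
      , b * Y - Q * (K * b ^ k + a * G k + a * a * X)
      , trans (u-+ n (suc k ℕ.* n))
          (trans (cong₂ (λ s t → a * s + b * t - P * a * t) eqₖ₊₁ eqₖ)
            (trans (ringT P a b (b ^ k) K (G k) X Y)
              (cong (λ c → c * (b * b ^ k) * a + a * a * G (suc k)
                             + a * a * a * (Y + b * X - P * G k - P * a * X))
                    (sym (ℤP.pos-+ 1 (suc k))))))
      , trans (u-+ (suc n) (suc k ℕ.* n))
          (trans (cong₂ (λ s t → b * s + (P * b - Q * a) * t - P * b * t) eqₖ₊₁ eqₖ)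
            (ringS P Q a b (b ^ k) K (G k) X Y))
      where
      K : ℤ
      K = + suc k
      ringT : ∀ P a b bk K G X Y →
        a * (b * bk + a * a * Y) + b * (K * bk * a + a * a * G + a * a * a * X)
          - P * a * (K * bk * a + a * a * G + a * a * a * X)
        ≡ (1ℤ + K) * (b * bk) * a + a * a * (G * b - P * K * bk)
          + a * a * a * (Y + b * X - P * G - P * a * X)
      ringT = solve-∀
      ringS : ∀ P Q a b bk K G X Y →
        b * (b * bk + a * a * Y) + (P * b - Q * a) * (K * bk * a + a * a * G + a * a * a * X)
          - P * b * (K * bk * a + a * a * G + a * a * a * X)
        ≡ b * (b * bk) + a * a * (b * Y - Q * (K * bk + a * G + a * a * X))
      ringS = solve-∀

    2G≡ : ∀ k → (+ 2) * G (suc k) ≡ - P * (+ suc k) * (+ suc (suc k)) * b ^ k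
    2G≡ zero = ring P b
      where
      ring : ∀ P b → (+ 2) * (0ℤ * b - P * 1ℤ * 1ℤ) ≡ - P * 1ℤ * (+ 2) * 1ℤ
      ring = solve-∀
    2G≡ (suc k) = begin
      (+ 2) * (G (suc k) * b - P * K₁ * (b * b ^ k))
        ≡⟨ ring₁ P b (b ^ k) (G (suc k)) K₁ ⟩
      ((+ 2) * G (suc k)) * b - (+ 2) * P * K₁ * (b * b ^ k)
        ≡⟨ cong (λ g → g * b - (+ 2) * P * K₁ * (b * b ^ k)) (2G≡ k) ⟩
      (- P * K * K₁ * b ^ k) * b - (+ 2) * P * K₁ * (b * b ^ k)
        ≡⟨ cong (λ c → (- P * K * c * b ^ k) * b - (+ 2) * P * c * (b * b ^ k)) K₁≡ ⟩
      (- P * K * (1ℤ + K) * b ^ k) * b - (+ 2) * P * (1ℤ + K) * (b * b ^ k)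
        ≡⟨ ring₂ P b (b ^ k) K ⟩
      - P * (1ℤ + K) * (1ℤ + (1ℤ + K)) * (b * b ^ k)
        ≡⟨ cong₂ (λ c d → - P * c * d * (b * b ^ k)) (sym K₁≡)
                 (trans (cong (λ c → 1ℤ + c) (sym K₁≡)) (sym (ℤP.pos-+ 1 (suc (suc k))))) ⟩
      - P * K₁ * (+ suc (suc (suc k))) * (b * b ^ k) ∎
      where
      open ≡-Reasoning
      K K₁ : ℤ
      K = + suc k
      K₁ = + suc (suc k)
      K₁≡ : K₁ ≡ 1ℤ + K
      K₁≡ = ℤP.pos-+ 1 (suc k)
      ring₁ : ∀ P b bk G K → (+ 2) * (G * b - P * K * (b * bk))
            ≡ ((+ 2) * G) * b - (+ 2) * P * K * (b * bk)
      ring₁ = solve-∀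
      ring₂ : ∀ P b bk K → (- P * K * (1ℤ + K) * bk) * b - (+ 2) * P * (1ℤ + K) * (b * bk)
            ≡ - P * (1ℤ + K) * (1ℤ + (1ℤ + K)) * (b * bk)
      ring₂ = solve-∀

countDiv-exact : ∀ {q} f m → 2 ℕ.≤ q → 1 ℕ.≤ m → m ℕ.≤ f →
  q ℕ.^ countDiv q f m ℕD.∣ m × ¬ (q ℕ.^ suc (countDiv q f m) ℕD.∣ m)
countDiv-exact zero m _ 1≤m m≤0 = ⊥-elim (ℕP.<-irrefl refl (ℕP.≤-trans 1≤m m≤0))
countDiv-exact {q@(suc (suc _))} (suc f) m q≥2 1≤m m≤f with q ℕD.∣? m
... | no q∤m = ℕD.divides m (sym (ℕP.*-identityʳ m))
             , λ h → q∤m (subst (ℕD._∣ m) (ℕP.*-identityʳ q) h)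
... | yes (ℕD.divides zero refl) = ⊥-elim (ℕP.1+n≰n 1≤m)
... | yes (ℕD.divides k@(suc _) refl) =
  subst Exact (sym (cong (countDiv q f) (m*n/n≡m k q))) (qᶜ⁺¹∣ , qᶜ⁺²∤)
  where
  Exact : ℕ → Set
  Exact j = q ℕ.^ suc j ℕD.∣ k ℕ.* q × ¬ (q ℕ.^ suc (suc j) ℕD.∣ k ℕ.* q)
  k≤f : k ℕ.≤ f
  k≤f = ℕP.≤-pred (ℕP.≤-trans (ℕP.m<m*n k q q≥2) m≤f)
  c : ℕ
  c = countDiv q f k
  ih : q ℕ.^ c ℕD.∣ k × ¬ (q ℕ.^ suc c ℕD.∣ k)
  ih = countDiv-exact f k q≥2 (s≤s z≤n) k≤f
  qᶜ⁺¹∣ : q ℕ.^ suc c ℕD.∣ k ℕ.* q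
  qᶜ⁺¹∣ = subst (ℕD._∣ k ℕ.* q) (ℕP.*-comm (q ℕ.^ c) q) (ℕD.*-monoˡ-∣ q (proj₁ ih))
  qᶜ⁺²∤ : ¬ (q ℕ.^ suc (suc c) ℕD.∣ k ℕ.* q)
  qᶜ⁺²∤ h = proj₂ ih (ℕD.*-cancelʳ-∣ q (subst (ℕD._∣ k ℕ.* q) (ℕP.*-comm q (q ℕ.^ suc c)) h))
countDiv-exact {zero} (suc f) m () _ _
countDiv-exact {suc zero} (suc f) m (s≤s ()) _ _

module PrimePower (p : ℕ) (pp : Prime p) where

  instance
    p≢0 : ℕ.NonZero p
    p≢0 = prime⇒nonZero pp

  pℤ : ℤ
  pℤ = + p

  p^ : ℕ → ℤ
  p^ j = + (p ℕ.^ j)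

  p^1≡p : p^ 1 ≡ pℤ
  p^1≡p = cong +_ (ℕP.*-identityʳ p)

  p^-suc : ∀ j → p^ (suc j) ≡ pℤ * p^ j
  p^-suc j = ℤP.pos-* p (p ℕ.^ j)

  p^-+ : ∀ i j → p^ (i ℕ.+ j) ≡ p^ i * p^ j
  p^-+ i j = trans (cong +_ (ℕP.^-distribˡ-+-* p i j)) (ℤP.pos-* (p ℕ.^ i) (p ℕ.^ j))

  p^-mono : ∀ {i j} → i ℕ.≤ j → p^ i ∣ p^ j
  p^-mono {i} {j} i≤j = ∣ᵤ⇒∣ (ℕD.divides (p ℕ.^ (j ℕ.∸ i))
    (trans (cong (p ℕ.^_) (sym (ℕP.m∸n+n≡m i≤j))) (ℕP.^-distribˡ-+-* p (j ℕ.∸ i) i)))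

  p∣p^ : ∀ {j} → 1 ℕ.≤ j → pℤ ∣ p^ j
  p∣p^ {suc j} _ = subst (pℤ ∣_) (sym (p^-suc j)) (∣m⇒∣m*n (p^ j) ∣-refl)

  p∣xy⇒p∣x⊎p∣y : ∀ x y → pℤ ∣ x * y → pℤ ∣ x ⊎ pℤ ∣ y
  p∣xy⇒p∣x⊎p∣y x y p∣xy = ⊎-map ∣ᵤ⇒∣ ∣ᵤ⇒∣
    (euclidsLemma (abs x) (abs y) pp (subst (p ℕD.∣_) (ℤP.abs-* x y) (∣⇒∣ᵤ p∣xy)))

  p∤1 : ¬ pℤ ∣ 1ℤ
  p∤1 p∣1 = ¬prime[1] (subst Prime (ℕD.∣1⇒≡1 (∣⇒∣ᵤ p∣1)) pp)

  p∤x⇒p∤x^ : ∀ {x} → ¬ pℤ ∣ x → ∀ k → ¬ pℤ ∣ x ^ k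
  p∤x⇒p∤x^ _ zero = p∤1
  p∤x⇒p∤x^ {x} p∤x (suc k) h = [ p∤x , p∤x⇒p∤x^ p∤x k ]′ (p∣xy⇒p∣x⊎p∣y x (x ^ k) h)

  p^∣*-cancelˡ : ∀ {x} j {y} → ¬ pℤ ∣ x → p^ j ∣ x * y → p^ j ∣ y
  p^∣*-cancelˡ zero {y} _ _ = ∣ᵤ⇒∣ (ℕD.1∣ abs y)
  p^∣*-cancelˡ {x} (suc j) {y} p∤x h with p∣xy⇒p∣x⊎p∣y x y (∣-trans (p∣p^ {suc j} (s≤s z≤n)) h)
  ... | inj₁ p∣x = ⊥-elim (p∤x p∣x)
  ... | inj₂ (divides y′ refl) =
    subst (_∣ y′ * pℤ) (trans (ℤP.*-comm (p^ j) pℤ) (sym (p^-suc j)))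
      (*-monoˡ-∣ pℤ (p^∣*-cancelˡ j p∤x (*-cancelʳ-∣ pℤ h′)))
    where
    h′ : p^ j * pℤ ∣ (x * y′) * pℤ
    h′ = subst₂ _∣_ (trans (p^-suc j) (ℤP.*-comm pℤ (p^ j))) (sym (ℤP.*-assoc x y′ pℤ)) h

  infix 4 p^_∥_

  record p^_∥_ (s : ℕ) (x : ℤ) : Set where
    constructor exact
    field
      pˢ∣ : p^ s ∣ x
      pˢ⁺¹∤ : ¬ p^ (suc s) ∣ x

  ∥⇒unit : ∀ {s x} → p^ s ∥ x → Σ ℤ λ w → x ≡ w * p^ s × ¬ pℤ ∣ w
  ∥⇒unit {s} (exact (divides w x≡wpˢ) pˢ⁺¹∤x) = w , x≡wpˢ , λ { (divides w′ refl) →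
    pˢ⁺¹∤x (divides w′
      (trans x≡wpˢ (trans (ℤP.*-assoc w′ pℤ (p^ s)) (cong (w′ *_) (sym (p^-suc s)))))) }

  unit⇒∥ : ∀ s {x} w → x ≡ w * p^ s → ¬ pℤ ∣ w → p^ s ∥ x
  unit⇒∥ s w x≡wpˢ p∤w = exact (divides w x≡wpˢ) λ { (divides z x≡zpˢ⁺¹) →
    p∤w (divides z (ℤP.*-cancelʳ-≡ w (z * pℤ) (p^ s) {{ℕP.m^n≢0 p s}}
      (trans (sym x≡wpˢ)
        (trans x≡zpˢ⁺¹ (trans (cong (z *_) (p^-suc s)) (sym (ℤP.*-assoc z pℤ (p^ s)))))))) }

  ∥-* : ∀ {s t x y} → p^ s ∥ x → p^ t ∥ y → p^ (s ℕ.+ t) ∥ x * y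
  ∥-* {s} {t} {x} {y} pˢ∥x pᵗ∥y with ∥⇒unit pˢ∥x | ∥⇒unit pᵗ∥y
  ... | w , x≡ , p∤w | v , y≡ , p∤v =
    unit⇒∥ (s ℕ.+ t) (w * v) xy≡ (λ h → [ p∤w , p∤v ]′ (p∣xy⇒p∣x⊎p∣y w v h))
    where
    ring : ∀ a b c d → (a * c) * (b * d) ≡ (a * b) * (c * d)
    ring = solve-∀
    xy≡ : x * y ≡ (w * v) * p^ (s ℕ.+ t)
    xy≡ = trans (cong₂ _*_ x≡ y≡)
            (trans (ring w v (p^ s) (p^ t)) (cong ((w * v) *_) (sym (p^-+ s t))))

  p∤⇒∥0 : ∀ {w} → ¬ pℤ ∣ w → p^ 0 ∥ w
  p∤⇒∥0 {w} = unit⇒∥ 0 w (sym (ℤP.*-identityʳ w))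

  ∥-*-unitʳ : ∀ {s x w} → p^ s ∥ x → ¬ pℤ ∣ w → p^ s ∥ x * w
  ∥-*-unitʳ {s} pˢ∥x p∤w = subst (p^_∥ _) (ℕP.+-identityʳ s) (∥-* pˢ∥x (p∤⇒∥0 p∤w))

  ∥-cancelˡ : ∀ {j c y} → ¬ pℤ ∣ c → p^ j ∥ c * y → p^ j ∥ y
  ∥-cancelˡ {j} {c} p∤c (exact pʲ∣cy pʲ⁺¹∤cy) =
    exact (p^∣*-cancelˡ j p∤c pʲ∣cy) (λ h → pʲ⁺¹∤cy (∣n⇒∣m*n c h))

  ∥∧∣⇒≤ : ∀ {t j x} → p^ t ∥ x → p^ j ∣ x → j ℕ.≤ t
  ∥∧∣⇒≤ {t} {j} (exact _ pᵗ⁺¹∤x) pʲ∣x with j ℕ.≤? t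
  ... | yes j≤t = j≤t
  ... | no j≰t = ⊥-elim (pᵗ⁺¹∤x (∣-trans (p^-mono (ℕP.≰⇒> j≰t)) pʲ∣x))

  ∥⇒p∣ : ∀ {s x} → 1 ℕ.≤ s → p^ s ∥ x → pℤ ∣ x
  ∥⇒p∣ {s} 1≤s pˢ∥x = ∣-trans (p∣p^ {s} 1≤s) (p^_∥_.pˢ∣ pˢ∥x)

  ∥∧p∣⇒1≤ : ∀ {t x} → p^ t ∥ x → pℤ ∣ x → 1 ℕ.≤ t
  ∥∧p∣⇒1≤ {x = x} pᵗ∥x p∣x = ∥∧∣⇒≤ pᵗ∥x (subst (_∣ x) (sym p^1≡p) p∣x)

  ν-spec : ∀ x → (ν p x ≡ ∞ × x ≡ 0ℤ) ⊎ Σ ℕ λ t → ν p x ≡ fin t × p^ t ∥ x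
  ν-spec x with abs x in |x|≡
  ... | zero = inj₁ (refl , ℤP.∣i∣≡0⇒i≡0 |x|≡)
  ... | suc m = inj₂ (c , refl
                     , exact (∣ᵤ⇒∣ (subst (_ ℕD.∣_) (sym |x|≡) (proj₁ countₚ)))
                             (λ h → proj₂ countₚ (subst (_ ℕD.∣_) |x|≡ (∣⇒∣ᵤ h))))
    where
    c : ℕ
    c = countDiv p (suc m) (suc m)
    countₚ : p ℕ.^ c ℕD.∣ suc m × ¬ (p ℕ.^ suc c ℕD.∣ suc m)
    countₚ = countDiv-exact (suc m) (suc m) (ℕ.nonTrivial⇒n>1 p {{prime⇒nonTrivial pp}})
                            (s≤s z≤n) ℕP.≤-refl

module Lifting (p : ℕ) (pp : Prime p) (P Q : ℤ) (p∤Q : ¬ + p ∣ Q) where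
  open PrimePower p pp
  open Lucas P Q

  p∣u⇒p∤u-suc : ∀ n → pℤ ∣ u n → ¬ pℤ ∣ u (suc n)
  p∣u⇒p∤u-suc zero _ = p∤1
  p∣u⇒p∤u-suc (suc n) p∣u₁ p∣u₂ =
    [ p∤Q , (λ p∣u₀ → p∣u⇒p∤u-suc n p∣u₀ p∣u₁) ]′ (p∣xy⇒p∣x⊎p∣y Q (u n) p∣Qu₀)
    where
    ring : ∀ P Q x y → P * x - (P * x - Q * y) ≡ Q * y
    ring = solve-∀
    p∣Qu₀ : pℤ ∣ Q * u n
    p∣Qu₀ = subst (pℤ ∣_) (ring P Q (u (suc n)) (u n)) (∣m∣n⇒∣m-n (∣n⇒∣m*n P p∣u₁) p∣u₂)

  p∣u∧p∣u-+⇒p∣u : ∀ m s → pℤ ∣ u m → pℤ ∣ u (m ℕ.+ s) → pℤ ∣ u s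
  p∣u∧p∣u-+⇒p∣u m s p∣uₘ p∣uₘ₊ₛ =
    [ (λ p∣uₘ₊₁ → ⊥-elim (p∣u⇒p∤u-suc m p∣uₘ p∣uₘ₊₁)) , (λ p∣uₛ → p∣uₛ) ]′
      (p∣xy⇒p∣x⊎p∣y (u (suc m)) (u s) p∣uₘ₊₁uₛ)
    where
    ring : ∀ P A B C D → A * B + C * D - P * A * D - A * (B - P * D) ≡ C * D
    ring = solve-∀
    p∣uₘ₊₁uₛ : pℤ ∣ u (suc m) * u s
    p∣uₘ₊₁uₛ = subst (pℤ ∣_) (ring P (u m) (u (suc s)) (u (suc m)) (u s))
      (∣m∣n⇒∣m-n (subst (pℤ ∣_) (u-+ m s) p∣uₘ₊ₛ) (∣m⇒∣m*n (u (suc s) - P * u s) p∣uₘ))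

  rank∣ : ∀ d .{{_ : ℕ.NonZero d}} → pℤ ∣ u d → (∀ s → 1 ℕ.≤ s → s ℕ.< d → ¬ pℤ ∣ u s)
        → ∀ n → pℤ ∣ u n → d ℕD.∣ n
  rank∣ d p∣ud below n p∣uₙ with n ℕ.% d in n%d≡
  ... | zero = ℕD.m%n≡0⇒n∣m n d n%d≡
  ... | suc s = ⊥-elim (below (suc s) (s≤s z≤n) (subst (ℕ._< d) n%d≡ (m%n<n n d)) p∣uₛ₊₁)
    where
    q : ℕ
    q = n ℕ./ d
    n≡ : n ≡ q ℕ.* d ℕ.+ suc s
    n≡ = trans (m≡m%n+[m/n]*n n d) (trans (cong (ℕ._+ q ℕ.* d) n%d≡) (ℕP.+-comm (suc s) (q ℕ.* d)))
    p∣uₛ₊₁ : pℤ ∣ u (suc s)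
    p∣uₛ₊₁ = p∣u∧p∣u-+⇒p∣u (q ℕ.* d) (suc s) (∣u⇒∣u-* d q p∣ud) (subst (λ k → pℤ ∣ u k) n≡ p∣uₙ)

  ∥-u-*-coprime : ∀ {s} c n → 1 ℕ.≤ s → ¬ p ℕD.∣ c → p^ s ∥ u n → p^ s ∥ u (c ℕ.* n)
  ∥-u-*-coprime zero _ _ p∤0 _ = ⊥-elim (p∤0 (p ℕD.∣0))
  ∥-u-*-coprime {s} (suc k) n 1≤s p∤c pˢ∥a = subst (p^ s ∥_) (sym u≡aW) (∥-*-unitʳ pˢ∥a p∤W)
    where
    open Expansion n
    ring : ∀ K bk a G X → K * bk * a + a * a * G + a * a * a * X ≡ a * (K * bk + a * (G + a * X))
    ring = solve-∀
    X : ℤ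
    X = proj₁ (u-*-expansion k)
    W : ℤ
    W = + suc k * b ^ k + a * (G k + a * X)
    u≡aW : u (suc k ℕ.* n) ≡ a * W
    u≡aW = trans (proj₁ (proj₂ (proj₂ (u-*-expansion k)))) (ring (+ suc k) (b ^ k) a (G k) X)
    p∣a : pℤ ∣ a
    p∣a = ∥⇒p∣ 1≤s pˢ∥a
    p∤W : ¬ pℤ ∣ W
    p∤W p∣W = [ (λ h → p∤c (∣⇒∣ᵤ h)) , p∤x⇒p∤x^ (p∣u⇒p∤u-suc n p∣a) k ]′
      (p∣xy⇒p∣x⊎p∣y (+ suc k) (b ^ k) (∣m+n∣n⇒∣m p∣W (∣m⇒∣m*n (G k + a * X) p∣a)))

  p^∣u-*⇒p∣ : ∀ {s} c n → 1 ℕ.≤ s → p^ s ∥ u n → p^ (suc s) ∣ u (c ℕ.* n) → p ℕD.∣ c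
  p^∣u-*⇒p∣ c n 1≤s pˢ∥uₙ pˢ⁺¹∣u with p ℕD.∣? c
  ... | yes p∣c = p∣c
  ... | no p∤c = ⊥-elim (p^_∥_.pˢ⁺¹∤ (∥-u-*-coprime c n 1≤s p∤c pˢ∥uₙ) pˢ⁺¹∣u)

  -- As 2G(p−1) = −P(p−1)p b^(p−2), doubling U(pn) = p b^(p−1) a + G(p−1) a² + a³X
  -- exhibits it as p·a times a unit.
  ∥-u-*p-odd : ∀ {s} n → ¬ pℤ ∣ + 2 → 1 ℕ.≤ s → p^ s ∥ u n → p^ (suc s) ∥ u (p ℕ.* n)
  ∥-u-*p-odd {s} n p∤2 1≤s pˢ∥a =
    subst (λ m → p^ (suc s) ∥ u (m ℕ.* n)) 2+k≡p
      (∥-cancelˡ p∤2 (subst (p^ (suc s) ∥_) (sym 2u≡paW) (∥-* p∥p (∥-*-unitʳ pˢ∥a p∤W))))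
    where
    open Expansion n
    open ≡-Reasoning
    k : ℕ
    k = p ℕ.∸ 2
    2+k≡p : 2 ℕ.+ k ≡ p
    2+k≡p = ℕP.m+[n∸m]≡n (ℕ.nonTrivial⇒n>1 p {{prime⇒nonTrivial pp}})
    K : ℤ
    K = + suc (suc k)
    X : ℤ
    X = proj₁ (u-*-expansion (suc k))
    p∣a : pℤ ∣ a
    p∣a = ∥⇒p∣ 1≤s pˢ∥a
    a₁ : ℤ
    a₁ = quotient p∣a
    a≡a₁K : a ≡ a₁ * K
    a≡a₁K = trans (_∣_.equality p∣a) (cong (a₁ *_) (sym (cong +_ 2+k≡p)))
    W : ℤ
    W = (+ 2) * b ^ suc k + a * (- P * (+ suc k) * b ^ k + (+ 2) * a₁ * X)
    ring₁ : ∀ K bk a G X → (+ 2) * (K * bk * a + a * a * G + a * a * a * X)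
          ≡ K * bk * a * (+ 2) + a * a * ((+ 2) * G) + (+ 2) * a * a * a * X
    ring₁ = solve-∀
    ring₂ : ∀ K bk bk′ a a₁ X P k₁ → K * bk * a * (+ 2) + a * a * (- P * k₁ * K * bk′)
            + (+ 2) * a * a * (a₁ * K) * X
          ≡ K * (a * ((+ 2) * bk + a * (- P * k₁ * bk′ + (+ 2) * a₁ * X)))
    ring₂ = solve-∀
    2u≡paW : (+ 2) * u (suc (suc k) ℕ.* n) ≡ pℤ * (a * W)
    2u≡paW = begin
      (+ 2) * u (suc (suc k) ℕ.* n)
        ≡⟨ cong ((+ 2) *_) (proj₁ (proj₂ (proj₂ (u-*-expansion (suc k))))) ⟩
      (+ 2) * (K * b ^ suc k * a + a * a * G (suc k) + a * a * a * X)
        ≡⟨ ring₁ K (b ^ suc k) a (G (suc k)) X ⟩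
      K * b ^ suc k * a * (+ 2) + a * a * ((+ 2) * G (suc k)) + (+ 2) * a * a * a * X
        ≡⟨ cong₂ (λ g a′ → K * b ^ suc k * a * (+ 2) + a * a * g + (+ 2) * a * a * a′ * X)
                 (2G≡ k) a≡a₁K ⟩
      K * b ^ suc k * a * (+ 2) + a * a * (- P * (+ suc k) * K * b ^ k) + (+ 2) * a * a * (a₁ * K) * X
        ≡⟨ ring₂ K (b ^ suc k) (b ^ k) a a₁ X P (+ suc k) ⟩
      K * (a * W)
        ≡⟨ cong (λ c → + c * (a * W)) 2+k≡p ⟩
      pℤ * (a * W) ∎
    p∥p : p^ 1 ∥ pℤ
    p∥p = unit⇒∥ 1 1ℤ (trans (sym p^1≡p) (sym (ℤP.*-identityˡ (p^ 1)))) p∤1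
    p∤W : ¬ pℤ ∣ W
    p∤W p∣W = [ p∤2 , p∤x⇒p∤x^ (p∣u⇒p∤u-suc n p∣a) (suc k) ]′
      (p∣xy⇒p∣x⊎p∣y (+ 2) (b ^ suc k)
        (∣m+n∣n⇒∣m p∣W (∣m⇒∣m*n (- P * (+ suc k) * b ^ k + (+ 2) * a₁ * X) p∣a)))

  LiftsFrom : ℕ → Set
  LiftsFrom t = ∀ m s → t ℕ.≤ s → p^ s ∥ u m → p^ (suc s) ∥ u (p ℕ.* m)

  module Classification (d j₀ : ℕ) (1≤j₀ : 1 ℕ.≤ j₀) (rank : ∀ n → p^ j₀ ∣ u n → d ℕD.∣ n) where

    ∣u⇔∣-below : ∀ {r} n → j₀ ℕ.≤ r → p^ r ∣ u d → (p^ r ∣ u n ⇔ d ℕD.∣ n)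
    ∣u⇔∣-below n j₀≤r pʳ∣ud = mk⇔ (λ pʳ∣uₙ → rank n (∣-trans (p^-mono j₀≤r) pʳ∣uₙ))
                                    (λ { (ℕD.divides c refl) → ∣u⇒∣u-* d c pʳ∣ud })

    module Above {t} (j₀≤t : j₀ ℕ.≤ t) (pᵗ∥ud : p^ t ∥ u d) (lifts : LiftsFrom t) where

      1≤t+ : ∀ e → 1 ℕ.≤ t ℕ.+ e
      1≤t+ e = ℕP.≤-trans (ℕP.≤-trans 1≤j₀ j₀≤t) (ℕP.m≤m+n t e)

      ∥-u-*p^ : ∀ e → p^ (t ℕ.+ e) ∥ u (d ℕ.* p ℕ.^ e)
      ∥-u-*p^ zero = subst₂ (λ j m → p^ j ∥ u m) (sym (ℕP.+-identityʳ t)) (sym (ℕP.*-identityʳ d)) pᵗ∥ud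
      ∥-u-*p^ (suc e) = subst₂ (λ j m → p^ j ∥ u m) (sym (ℕP.+-suc t e)) (ring p d (p ℕ.^ e))
                          (lifts (d ℕ.* p ℕ.^ e) (t ℕ.+ e) (ℕP.m≤m+n t e) (∥-u-*p^ e))
        where
        ring : ∀ p d x → p ℕ.* (d ℕ.* x) ≡ d ℕ.* (p ℕ.* x)
        ring = ℕ-solve-∀

      p^∣u⇒∣ : ∀ e n → p^ (t ℕ.+ e) ∣ u n → d ℕ.* p ℕ.^ e ℕD.∣ n
      p^∣u⇒∣ zero n pᵗ∣uₙ = subst (ℕD._∣ n) (sym (ℕP.*-identityʳ d))
        (rank n (∣-trans (p^-mono (ℕP.≤-trans j₀≤t (ℕP.m≤m+n t 0))) pᵗ∣uₙ))
      p^∣u⇒∣ (suc e) n pᵗ⁺ᵉ⁺¹∣uₙ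
        with p^∣u⇒∣ e n (∣-trans (p^-mono (ℕP.+-monoʳ-≤ t (ℕP.n≤1+n e))) pᵗ⁺ᵉ⁺¹∣uₙ)
      ... | ℕD.divides c refl
        with p^∣u-*⇒p∣ c (d ℕ.* p ℕ.^ e) (1≤t+ e) (∥-u-*p^ e)
               (subst (λ j → p^ j ∣ u (c ℕ.* (d ℕ.* p ℕ.^ e))) (ℕP.+-suc t e) pᵗ⁺ᵉ⁺¹∣uₙ)
      ...   | ℕD.divides c′ refl = ℕD.divides c′ (ring c′ p d (p ℕ.^ e))
        where
        ring : ∀ c p d x → c ℕ.* p ℕ.* (d ℕ.* x) ≡ c ℕ.* (d ℕ.* (p ℕ.* x))
        ring = ℕ-solve-∀

      ∣u⇔∣-above : ∀ e n → p^ (t ℕ.+ e) ∣ u n ⇔ d ℕ.* p ℕ.^ e ℕD.∣ n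
      ∣u⇔∣-above e n = mk⇔ (p^∣u⇒∣ e n)
        (λ { (ℕD.divides c refl) → ∣u⇒∣u-* (d ℕ.* p ℕ.^ e) c (p^_∥_.pˢ∣ (∥-u-*p^ e)) })

    classify : (∀ {t} → p^ t ∥ u d → j₀ ℕ.≤ t × LiftsFrom t)
             → ∀ {r} → j₀ ℕ.≤ r → ∀ n → p^ r ∣ u n ⇔ d ℕ.* p ℕ.^ posSub r (ν p (u d)) ℕD.∣ n
    classify valuation {r} j₀≤r n with ν-spec (u d)
    ... | inj₁ (ν≡∞ , ud≡0) rewrite ν≡∞ | ℕP.*-identityʳ d =
      ∣u⇔∣-below n j₀≤r (subst (p^ r ∣_) (sym ud≡0) (divides 0ℤ refl))
    ... | inj₂ (t , ν≡t , pᵗ∥ud) rewrite ν≡t with ℕP.≤-total r t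
    ...   | inj₁ r≤t rewrite ℕP.m≤n⇒m∸n≡0 r≤t | ℕP.*-identityʳ d =
      ∣u⇔∣-below n j₀≤r (∣-trans (p^-mono r≤t) (p^_∥_.pˢ∣ pᵗ∥ud))
    ...   | inj₂ t≤r = subst (λ j → p^ j ∣ u n ⇔ d ℕ.* p ℕ.^ (r ℕ.∸ t) ℕD.∣ n) (ℕP.m+[n∸m]≡n t≤r)
                             (∣u⇔∣-above (r ℕ.∸ t) n)
      where open Above (proj₁ (valuation pᵗ∥ud)) pᵗ∥ud (proj₂ (valuation pᵗ∥ud))

4∣odd²-1 : ∀ x → ¬ + 2 ∣ x → + 4 ∣ x * x - 1ℤ
4∣odd²-1 x 2∤x with x ℤDM.% + 2 | ℤDM.n%d<d x (+ 2) | ℤDM.a≡a%n+[a/n]*n x (+ 2)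
... | zero | _ | x≡2k = ⊥-elim (2∤x (divides (x ℤDM./ + 2) (trans x≡2k (ℤP.+-identityˡ _))))
... | suc zero | _ | x≡2k+1 = divides (k * k + k) (trans (cong (λ y → y * y - 1ℤ) x≡2k+1) (ring k))
  where
  k : ℤ
  k = x ℤDM./ + 2
  ring : ∀ k → (1ℤ + k * + 2) * (1ℤ + k * + 2) - 1ℤ ≡ (k * k + k) * + 4
  ring = solve-∀
... | suc (suc _) | s≤s (s≤s ()) | _

InL≐⟨⟩ : ∀ {P Q} p r {a} → (∀ n → + (p ℕ.^ r) ∣ U P Q n ⇔ a ℕD.∣ n) → InL P Q p r ≐ ⟨ a ⟩
InL≐⟨⟩ _ _ classified n =
    (λ pʳ∣uₙ → Equivalence.from ⟨⟩⇔∣ (Equivalence.to (classified n) (∣ᵤ⇒∣ pʳ∣uₙ)))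
  , (λ a∣n → ∣⇒∣ᵤ (Equivalence.from (classified n) (Equivalence.to ⟨⟩⇔∣ a∣n)))

InL≐Zero : ∀ P Q p → Prime p → ¬ (+ p ℤD.∣ gcd P Q) → ∀ r → 1 ℕ.≤ r → + p ℤD.∣ Q
         → InL P Q p r ≐ Zero
InL≐Zero P Q p pp p∤gcd r 1≤r p∣Q n = to n , λ { refl → ℕD.divides 0 refl }
  where
  open PrimePower p pp
  open Lucas P Q
  p∤P : ¬ pℤ ∣ P
  p∤P p∣P = p∤gcd (gcd-greatest {P} {Q} {pℤ} (∣⇒∣ᵤ p∣P) p∣Q)
  p∤u-suc : ∀ n → ¬ pℤ ∣ u (suc n)
  p∤u-suc zero = p∤1
  p∤u-suc (suc n) p∣u₂ = [ p∤P , p∤u-suc n ]′ (p∣xy⇒p∣x⊎p∣y P (u (suc n)) p∣Pu₁)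
    where
    ring : ∀ P Q x y → P * x - Q * y + Q * y ≡ P * x
    ring = solve-∀
    p∣Pu₁ : pℤ ∣ P * u (suc n)
    p∣Pu₁ = subst (pℤ ∣_) (ring P Q (u (suc n)) (u n))
              (∣m∣n⇒∣m+n p∣u₂ (∣m⇒∣m*n (u n) (∣ᵤ⇒∣ {pℤ} {Q} p∣Q)))
  to : ∀ n → InL P Q p r n → n ≡ 0
  to zero _ = refl
  to (suc n) pʳ∣u = ⊥-elim (p∤u-suc n (∣-trans (p∣p^ {r} 1≤r) (∣ᵤ⇒∣ pʳ∣u)))

InL-odd-prime : ∀ P Q p → Prime p → 3 ℕ.≤ p → ¬ (+ p ℤD.∣ Q) → ∀ ρ → IsRank P Q p ρ
              → ∀ r → 1 ℕ.≤ r → InL P Q p r ≐ ⟨ p ℕ.^ posSub r (ν p (U P Q ρ)) ℕ.* ρ ⟩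
InL-odd-prime P Q p pp 3≤p p∤Q ρ (2≤ρ , p∣uρ , minimal) r 1≤r =
  InL≐⟨⟩ p r λ n → subst (λ a → p^ r ∣ u n ⇔ a ℕD.∣ n) (ℕP.*-comm ρ (p ℕ.^ posSub r (ν p (u ρ))))
                    (classify valuation 1≤r n)
  where
  open PrimePower p pp
  open Lucas P Q
  open Lifting p pp P Q (λ p∣Q → p∤Q (∣⇒∣ᵤ p∣Q))
  instance
    ρ≢0 : ℕ.NonZero ρ
    ρ≢0 = ℕ.>-nonZero (ℕP.≤-trans (s≤s z≤n) 2≤ρ)
  below : ∀ s → 1 ℕ.≤ s → s ℕ.< ρ → ¬ pℤ ∣ u s
  below (suc zero) _ _ = p∤1
  below (suc (suc s)) _ s<ρ p∣u = ℕP.<⇒≱ s<ρ (minimal (suc (suc s)) (s≤s (s≤s z≤n)) (∣⇒∣ᵤ p∣u))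
  rank : ∀ n → p^ 1 ∣ u n → ρ ℕD.∣ n
  rank n p∣uₙ = rank∣ ρ (∣ᵤ⇒∣ p∣uρ) below n (subst (_∣ u n) p^1≡p p∣uₙ)
  p∤2 : ¬ pℤ ∣ + 2
  p∤2 p∣2 = ℕP.<⇒≱ 3≤p (ℕD.∣⇒≤ (∣⇒∣ᵤ p∣2))
  open Classification ρ 1 (s≤s z≤n) rank
  valuation : ∀ {t} → p^ t ∥ u ρ → 1 ℕ.≤ t × LiftsFrom t
  valuation {t} pᵗ∥uρ = 1≤t , λ m _ t≤s pˢ∥uₘ → ∥-u-*p-odd m p∤2 (ℕP.≤-trans 1≤t t≤s) pˢ∥uₘ
    where
    1≤t : 1 ℕ.≤ t
    1≤t = ∥∧p∣⇒1≤ pᵗ∥uρ (∣ᵤ⇒∣ p∣uρ)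

*-pres-∣ : ∀ {a b x y} → a ∣ x → b ∣ y → a * b ∣ x * y
*-pres-∣ {b = b} {x} a∣x b∣y = ∣-trans (*-monoˡ-∣ b a∣x) (*-monoʳ-∣ x b∣y)

module AtTwo (P Q : ℤ) (2∤Q : ¬ + 2 ℤD.∣ Q) where
  open PrimePower 2 prime[2]
  open Lucas P Q
  open Lifting 2 prime[2] P Q (λ 2∣Q → 2∤Q (∣⇒∣ᵤ 2∣Q))

  -- 4 ∣ P U n makes the second factor of U(2n) = U n (2U(n+1) − P U n) exactly even.
  ∥-u-*2 : ∀ {s} n → 1 ℕ.≤ s → + 4 ∣ P * u n → p^ s ∥ u n → p^ (suc s) ∥ u (2 ℕ.* n)
  ∥-u-*2 {s} n 1≤s 4∣Pa pˢ∥a =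
    subst (p^ (suc s) ∥_) (sym (u-double n)) (subst (p^_∥ a * w) (ℕP.+-comm s 1) (∥-* pˢ∥a 2∥w))
    where
    a b w : ℤ
    a = u n
    b = u (suc n)
    w = (+ 2) * b - P * a
    ring : ∀ P a b → (+ 2) * b - P * a + P * a ≡ (+ 2) * b
    ring = solve-∀
    2∥w : p^ 1 ∥ w
    2∥w = exact (∣m∣n⇒∣m-n (∣m⇒∣m*n b ∣-refl) (∣-trans (divides (+ 2) refl) 4∣Pa))
                (λ 4∣w → p∣u⇒p∤u-suc n (∥⇒p∣ 1≤s pˢ∥a)
                   (*-cancelˡ-∣ (+ 2) {+ 2} {b} (subst (+ 4 ∣_) (ring P a b) (∣m∣n⇒∣m+n 4∣w 4∣Pa))))

  lifts-if-4∣Pu : ∀ {t} → 1 ℕ.≤ t → (∀ m s → t ℕ.≤ s → p^ s ∥ u m → + 4 ∣ P * u m) → LiftsFrom t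
  lifts-if-4∣Pu 1≤t 4∣Pu m s t≤s pˢ∥uₘ = ∥-u-*2 m (ℕP.≤-trans 1≤t t≤s) (4∣Pu m s t≤s pˢ∥uₘ) pˢ∥uₘ

  lifts-from-2 : ∀ {t} → 2 ℕ.≤ t → LiftsFrom t
  lifts-from-2 2≤t = lifts-if-4∣Pu (ℕP.≤-trans (s≤s z≤n) 2≤t)
    λ m s t≤s pˢ∥uₘ → ∣n⇒∣m*n P (∣-trans (p^-mono {2} {s} (ℕP.≤-trans 2≤t t≤s)) (p^_∥_.pˢ∣ pˢ∥uₘ))

  InL-P-even : + 2 ℤD.∣ P → ∀ r → 1 ℕ.≤ r → InL P Q 2 r ≐ ⟨ 2 ℕ.^ (1 ℕ.+ posSub r (ν 2 P)) ⟩
  InL-P-even 2∣P r 1≤r = InL≐⟨⟩ 2 r λ n →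
      subst (λ x → p^ r ∣ u n ⇔ 2 ℕ.* 2 ℕ.^ posSub r (ν 2 x) ℕD.∣ n) u-2
        (classify valuation 1≤r n)
    where
    2∣u₂ : pℤ ∣ u 2
    2∣u₂ = subst (pℤ ∣_) (sym u-2) (∣ᵤ⇒∣ 2∣P)
    below : ∀ s → 1 ℕ.≤ s → s ℕ.< 2 → ¬ pℤ ∣ u s
    below (suc zero) _ _ = p∤1
    below (suc (suc _)) _ (s≤s (s≤s ()))
    open Classification 2 1 (s≤s z≤n) (rank∣ 2 2∣u₂ below)
    valuation : ∀ {t} → p^ t ∥ u 2 → 1 ℕ.≤ t × LiftsFrom t
    valuation {t} pᵗ∥u₂ = 1≤t , lifts-if-4∣Pu 1≤t λ m s t≤s pˢ∥uₘ →
        subst (+ 4 ∣_) (ℤP.*-comm (u m) P)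
          (*-pres-∣ {pℤ} {pℤ} (∥⇒p∣ (ℕP.≤-trans 1≤t t≤s) pˢ∥uₘ) (∣ᵤ⇒∣ 2∣P))
      where
      1≤t : 1 ℕ.≤ t
      1≤t = ∥∧p∣⇒1≤ pᵗ∥u₂ 2∣u₂

  module OddP (2∤P : ¬ + 2 ℤD.∣ P) where

    rank₃ : pℤ ∣ u 3 → ∀ n → p^ 1 ∣ u n → 3 ℕD.∣ n
    rank₃ 2∣u₃ = rank∣ 3 2∣u₃ below
      where
      below : ∀ s → 1 ℕ.≤ s → s ℕ.< 3 → ¬ pℤ ∣ u s
      below (suc zero) _ _ = p∤1
      below (suc (suc zero)) _ _ 2∣u₂ = 2∤P (∣⇒∣ᵤ (subst (pℤ ∣_) u-2 2∣u₂))
      below (suc (suc (suc _))) _ (s≤s (s≤s (s≤s ())))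

    4∣P²-1 : + 4 ∣ P * P - 1ℤ
    4∣P²-1 = 4∣odd²-1 P (λ 2∣P → 2∤P (∣⇒∣ᵤ 2∣P))

    InL-Q≡1 : + 4 ℤD.∣ Q - 1ℤ → ∀ r → 1 ℕ.≤ r → InL P Q 2 r ≐ ⟨ 3 ℕ.* 2 ℕ.^ posSub r (ν 2 (U P Q 3)) ⟩
    InL-Q≡1 4∣Q-1 r 1≤r = InL≐⟨⟩ 2 r (classify valuation 1≤r)
      where
      ring : ∀ P Q → P * P - Q ≡ (P * P - 1ℤ) - (Q - 1ℤ)
      ring = solve-∀
      4∣u₃ : + 4 ∣ u 3
      4∣u₃ = subst (+ 4 ∣_) (sym (trans u-3 (ring P Q))) (∣m∣n⇒∣m-n 4∣P²-1 (∣ᵤ⇒∣ 4∣Q-1))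
      open Classification 3 1 (s≤s z≤n) (rank₃ (∣-trans (divides (+ 2) refl) 4∣u₃))
      valuation : ∀ {t} → p^ t ∥ u 3 → 1 ℕ.≤ t × LiftsFrom t
      valuation {t} pᵗ∥u₃ = ℕP.≤-trans (s≤s z≤n) 2≤t , lifts-from-2 2≤t
        where
        2≤t : 2 ℕ.≤ t
        2≤t = ∥∧∣⇒≤ {j = 2} pᵗ∥u₃ 4∣u₃

    module Q≡-1 (4∣Q+1 : + 4 ℤD.∣ Q - - 1ℤ) where

      2∥u₃ : p^ 1 ∥ u 3
      2∥u₃ = exact (subst (pℤ ∣_) (ring₂ (u 3))
                     (∣m∣n⇒∣m+n (∣-trans (divides (+ 2) refl) 4∣u₃-2) ∣-refl))
                   (λ 4∣u₃ → 4∤2 (subst (+ 4 ∣_) (ring₃ (u 3)) (∣m∣n⇒∣m-n 4∣u₃ 4∣u₃-2)))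
        where
        ring₁ : ∀ P Q → P * P - Q - + 2 ≡ (P * P - 1ℤ) - (Q - - 1ℤ)
        ring₁ = solve-∀
        ring₂ : ∀ x → x - + 2 + + 2 ≡ x
        ring₂ = solve-∀
        ring₃ : ∀ x → x - (x - + 2) ≡ + 2
        ring₃ = solve-∀
        4∣u₃-2 : + 4 ∣ u 3 - + 2
        4∣u₃-2 = subst (+ 4 ∣_) (sym (trans (cong (_- + 2) u-3) (ring₁ P Q)))
                   (∣m∣n⇒∣m-n 4∣P²-1 (∣ᵤ⇒∣ 4∣Q+1))
        4∤2 : ¬ + 4 ∣ + 2
        4∤2 4∣2 with ℕD.∣⇒≤ (∣⇒∣ᵤ 4∣2)
        ... | s≤s (s≤s ())

      2∣u₃ : pℤ ∣ u 3
      2∣u₃ = p^_∥_.pˢ∣ 2∥u₃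

      InL-r≡1 : InL P Q 2 1 ≐ ⟨ 3 ⟩
      InL-r≡1 = InL≐⟨⟩ 2 1 λ n → ∣u⇔∣-below n ℕP.≤-refl 2∣u₃
        where open Classification 3 1 (s≤s z≤n) (rank₃ 2∣u₃)

      -- n = 3c, and an odd c would keep ν₂(U n) = ν₂(U 3) = 1.
      rank₆ : ∀ n → p^ 2 ∣ u n → 6 ℕD.∣ n
      rank₆ n 4∣uₙ = ℕD.divides (ℕD.quotient 2∣c)
          (trans n≡c*3 (trans (cong (ℕ._* 3) (ℕD._∣_.equality 2∣c)) (ℕP.*-assoc (ℕD.quotient 2∣c) 2 3)))
        where
        3∣n : 3 ℕD.∣ n
        3∣n = rank₃ 2∣u₃ n (∣-trans (divides (+ 2) refl) 4∣uₙ)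
        c : ℕ
        c = ℕD.quotient 3∣n
        n≡c*3 : n ≡ c ℕ.* 3
        n≡c*3 = ℕD._∣_.equality 3∣n
        2∣c : 2 ℕD.∣ c
        2∣c = p^∣u-*⇒p∣ c 3 ℕP.≤-refl 2∥u₃ (subst (λ k → p^ 2 ∣ u k) n≡c*3 4∣uₙ)

      4∣u₆ : + 4 ∣ u 6
      4∣u₆ = subst (+ 4 ∣_) (sym (u-double 3))
        (*-pres-∣ 2∣u₃ (∣m∣n⇒∣m-n (∣m⇒∣m*n (u 4) ∣-refl) (∣n⇒∣m*n P 2∣u₃)))

      InL-r≥2 : ∀ r → 2 ℕ.≤ r → InL P Q 2 r ≐ ⟨ 6 ℕ.* 2 ℕ.^ posSub r (ν 2 (U P Q 6)) ⟩
      InL-r≥2 r 2≤r = InL≐⟨⟩ 2 r (classify valuation 2≤r)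
        where
        open Classification 6 2 (s≤s z≤n) rank₆
        valuation : ∀ {t} → p^ t ∥ u 6 → 2 ℕ.≤ t × LiftsFrom t
        valuation {t} pᵗ∥u₆ = 2≤t , lifts-from-2 2≤t
          where
          2≤t : 2 ℕ.≤ t
          2≤t = ∥∧∣⇒≤ {j = 2} pᵗ∥u₆ 4∣u₆

theorem4p1 : (P Q : ℤ) → P ℤ.* Q ≢ ℤ.0ℤ → (p : ℕ) → Prime p
    → ¬ ((+ p) ℤD.∣ gcd P Q) → (r : ℕ) → 1 ℕ.≤ r
    → ((+ p) ℤD.∣ Q → InL P Q p r ≐ Zero)
    × (3 ℕ.≤ p → ¬ ((+ p) ℤD.∣ Q) → (ρ : ℕ) → IsRank P Q p ρ
        → InL P Q p r ≐ ⟨ p ℕ.^ posSub r (ν p (U P Q ρ)) ℕ.* ρ ⟩)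
    × (p ≡ 2 → (+ 2) ℤD.∣ P → ¬ ((+ 2) ℤD.∣ Q)
        → InL P Q p r ≐ ⟨ 2 ℕ.^ (1 ℕ.+ posSub r (ν 2 P)) ⟩)
    × (p ≡ 2 → ¬ ((+ 2) ℤD.∣ P) → ¬ ((+ 2) ℤD.∣ Q) → (+ 4) ℤD.∣ (Q - ℤ.1ℤ)
        → InL P Q p r ≐ ⟨ 3 ℕ.* 2 ℕ.^ posSub r (ν 2 (U P Q 3)) ⟩)
    × (p ≡ 2 → ¬ ((+ 2) ℤD.∣ P) → ¬ ((+ 2) ℤD.∣ Q) → (+ 4) ℤD.∣ (Q - (- ℤ.1ℤ)) → r ≡ 1
        → InL P Q p r ≐ ⟨ 3 ⟩)
    × (p ≡ 2 → ¬ ((+ 2) ℤD.∣ P) → ¬ ((+ 2) ℤD.∣ Q) → (+ 4) ℤD.∣ (Q - (- ℤ.1ℤ)) → r ≢ 1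
        → InL P Q p r ≐ ⟨ 6 ℕ.* 2 ℕ.^ posSub r (ν 2 (U P Q 6)) ⟩)
theorem4p1 P Q _ p pp p∤gcd r 1≤r =
    InL≐Zero P Q p pp p∤gcd r 1≤r
  , (λ 3≤p p∤Q ρ isRank → InL-odd-prime P Q p pp 3≤p p∤Q ρ isRank r 1≤r)
  , (λ { refl 2∣P 2∤Q → AtTwo.InL-P-even P Q 2∤Q 2∣P r 1≤r })
  , (λ { refl 2∤P 2∤Q 4∣Q-1 → AtTwo.OddP.InL-Q≡1 P Q 2∤Q 2∤P 4∣Q-1 r 1≤r })
  , (λ { refl 2∤P 2∤Q 4∣Q+1 refl → AtTwo.OddP.Q≡-1.InL-r≡1 P Q 2∤Q 2∤P 4∣Q+1 })
  , (λ { refl 2∤P 2∤Q 4∣Q+1 r≢1 →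
         AtTwo.OddP.Q≡-1.InL-r≥2 P Q 2∤Q 2∤P 4∣Q+1 r (ℕP.≤∧≢⇒< 1≤r (λ 1≡r → r≢1 (sym 1≡r))) })
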